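{- Let $G$ be a graph with non-adjacent vertices $s,t$ and canonical paths $P_1,\dots,P_k$ such that every vertex of $G$ lies on some $P_i$, and let $S\subseteq V(G)\setminus\{s,t\}$ contain exactly one vertex of each $P_i$. Then $S$ is an $s$-$t$-separator if and only if $G-S$ contains no $s$-$t$-path of the form $u_{i,1}=s,u_{i,2},\dots,u_{i,a},u_{j,b},u_{j,b+1},\dots,u_{j,L(j)}=t$ with $i\neq j$ and $\{u_{i,a},u_{j,b}\}\in E(G)$, i.e. a path that follows one canonical path from $s$, uses exactly one edge between two different canonical paths, and then follows the second canonical path to $t$.
   Context: Graphs are finite, simple, undirected. An $s$-$t$-separator is a set $S\subseteq V(G)\setminus\{s,t\}$ such that $s,t$ are in different components of $G-S$; $k$ is the minimum size of one. Canonical paths: a fixed set of $k$ pairwise internally vertex-disjoint chordless $s$-$t$-paths $P_1,\dots,P_k$ (chordless: every edge between two vertices of $P_i$ is an edge of $P_i$). The vertices of $P_i$ in order are $u_{i,1}=s,\dots,u_{i,L(i)}=t$. -}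

module Defs where

open import Data.Nat using (ℕ; suc; _≤_)
open import Data.Fin using (Fin; toℕ)
open import Data.Fin.Subset using (Subset; _∈_; _∉_; ∣_∣)
open import Data.List using (List; head; last; lookup; length; take; drop; _++_)
open import Data.List.Relation.Unary.Linked using (Linked)
open import Data.List.Relation.Unary.Unique.Propositional using (Unique)
open import Data.List.Relation.Unary.All using (All)
import Data.List.Membership.Propositional as L
open import Data.Maybe using (just)
open import Data.Product using (Σ; ∃; ∃-syntax; _×_)
open import Data.Sum using (_⊎_)
open import Relation.Binary.PropositionalEquality using (_≡_)
open import Relation.Nullary using (¬_)

record Graph (n : ℕ) : Set₁ where
  field
    Adj   : Fin n → Fin n → Set
    sym   : ∀ {u v} → Adj u v → Adj v u
    irrefl : ∀ {v} → ¬ Adj v v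
open Graph public

module _ {n : ℕ} (G : Graph n) where

  IsPath : Fin n → Fin n → List (Fin n) → Set
  IsPath s t xs = Linked (Adj G) xs × Unique xs × head xs ≡ just s × last xs ≡ just t

  Chordless : List (Fin n) → Set
  Chordless xs = ∀ (p q : Fin (length xs)) → Adj G (lookup xs p) (lookup xs q) →
                 toℕ q ≡ suc (toℕ p) ⊎ toℕ p ≡ suc (toℕ q)

  data ConnAvoid (S : Subset n) : Fin n → Fin n → Set where
    here : ∀ {v} → v ∉ S → ConnAvoid S v v
    step : ∀ {u w v} → u ∉ S → Adj G u w → ConnAvoid S w v → ConnAvoid S u v

  IsSeparator : Fin n → Fin n → Subset n → Set
  IsSeparator s t S = s ∉ S × t ∉ S × ¬ ConnAvoid S s t

  IsMinSepSize : Fin n → Fin n → ℕ → Set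
  IsMinSepSize s t k = (∃[ S ] (IsSeparator s t S × ∣ S ∣ ≡ k)) ×
                       (∀ S → IsSeparator s t S → k ≤ ∣ S ∣)

  IsCanonical : Fin n → Fin n → (k : ℕ) → (Fin k → List (Fin n)) → Set
  IsCanonical s t k P =
    IsMinSepSize s t k ×
    (∀ i → IsPath s t (P i) × Chordless (P i)) ×
    (∀ i j → ¬ i ≡ j → ∀ v → v L.∈ P i → v L.∈ P j → v ≡ s ⊎ v ≡ t)

  -- The s-t-path u_{i,1},…,u_{i,a},u_{j,b},…,u_{j,L(j)} (0-based indices a, b into P i, P j).
  crossPath : ∀ {k} (P : Fin k → List (Fin n)) (i j : Fin k) →
              Fin (length (P i)) → Fin (length (P j)) → List (Fin n)
  crossPath P i j a b = take (suc (toℕ a)) (P i) ++ drop (toℕ b) (P j)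

  HasCrossPath : Fin n → Fin n → ∀ {k} → (Fin k → List (Fin n)) → Subset n → Set
  HasCrossPath s t {k} P S =
    Σ (Fin k) λ i → Σ (Fin k) λ j → ¬ i ≡ j ×
    Σ (Fin (length (P i))) λ a → Σ (Fin (length (P j))) λ b →
      Adj G (lookup (P i) a) (lookup (P j) b) ×
      IsPath s t (crossPath P i j a b) ×
      All (λ v → v ∉ S) (crossPath P i j a b)

-- A cross path avoiding S is an s-t-path in G - S. Conversely, let x_i be the
-- vertex of S on P_i and say that a vertex lies before the cut if it strictly
-- precedes x_i on some P_i; s does and t does not. Every neighbour w ∉ S of a
-- vertex u before the cut on P_i lies before the cut: w lies on some P_j, and
-- if it came after x_j then for j = i the edge uw would be a chord of P_i,
-- while for j ≠ i it would complete a cross path avoiding S. Hence the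
-- component of s in G - S lies before the cut and misses t.
{-# OPTIONS --safe #-}
module Submission where

open import Defs hiding (sym)
open import Data.Nat using (ℕ; zero; suc; _<_; _≤_; z≤n; s≤s)
open import Data.Nat.Properties
open import Data.Fin using (Fin; toℕ; zero; suc)
open import Data.Fin.Properties using (toℕ-injective; toℕ<n) renaming (_≟_ to _≟ᶠ_)
open import Data.Fin.Subset using (Subset; _∈_; _∉_)
open import Data.List using (List; []; _∷_; head; last; lookup; length; take; drop; _++_)
open import Data.List.Relation.Unary.Linked using (Linked; []; [-]; _∷_)
import Data.List.Relation.Unary.Linked.Properties as Linked
open import Data.List.Relation.Unary.All as All using (All; _∷_)
import Data.List.Relation.Unary.All.Properties as AllP
open import Data.List.Relation.Unary.Any using (here; there; index)
open import Data.List.Relation.Unary.Any.Properties using (lookup-index)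
open import Data.List.Relation.Unary.AllPairs using (_∷_)
open import Data.List.Relation.Unary.Unique.Propositional using (Unique)
import Data.List.Relation.Unary.Unique.Propositional.Properties as Unique
open import Data.List.Relation.Binary.Disjoint.Propositional using (Disjoint)
import Data.List.Membership.Propositional as L
open import Data.List.Membership.Propositional.Properties using (∈-lookup)
open import Data.Maybe using (just)
open import Data.Maybe.Relation.Binary.Connected using (Connected; just)
open import Data.Product using (Σ; ∃-syntax; _×_; _,_; proj₁; proj₂)
open import Data.Sum using (_⊎_; inj₁; inj₂)
open import Data.Empty using (⊥-elim)
open import Relation.Binary.Definitions using (tri<; tri≈; tri>)
open import Relation.Binary.PropositionalEquality
  using (_≡_; _≢_; refl; sym; trans; cong; subst; subst₂)
open import Relation.Nullary using (¬_; yes; no)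
open import Function using (_∘_)
open import Function.Bundles using (_⇔_; mk⇔)

module _ {A : Set} where

  Linked-take⁺ : ∀ {ℓ} {R : A → A → Set ℓ} m {xs} → Linked R xs → Linked R (take m xs)
  Linked-take⁺ zero          _        = []
  Linked-take⁺ (suc m)       []       = []
  Linked-take⁺ (suc zero)    [-]      = [-]
  Linked-take⁺ (suc (suc m)) [-]      = [-]
  Linked-take⁺ (suc zero)    (_ ∷ _)  = [-]
  Linked-take⁺ (suc (suc m)) (r ∷ rs) = r ∷ Linked-take⁺ (suc m) rs

  Linked-drop⁺ : ∀ {ℓ} {R : A → A → Set ℓ} m {xs} → Linked R xs → Linked R (drop m xs)
  Linked-drop⁺ zero    rs       = rs
  Linked-drop⁺ (suc m) []       = []
  Linked-drop⁺ (suc m) [-]      = Linked-drop⁺ m []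
  Linked-drop⁺ (suc m) (_ ∷ rs) = Linked-drop⁺ m rs

  Unique⇒lookup-injective : ∀ {xs : List A} → Unique xs → ∀ p q → lookup xs p ≡ lookup xs q → p ≡ q
  Unique⇒lookup-injective {_ ∷ _} _          zero    zero    _  = refl
  Unique⇒lookup-injective {_ ∷ _} (x∉ ∷ _)   zero    (suc q) eq = ⊥-elim (All.lookup x∉ (∈-lookup q) eq)
  Unique⇒lookup-injective {_ ∷ _} (x∉ ∷ _)   (suc p) zero    eq = ⊥-elim (All.lookup x∉ (∈-lookup p) (sym eq))
  Unique⇒lookup-injective {_ ∷ _} (_ ∷ uniq) (suc p) (suc q) eq =
    cong suc (Unique⇒lookup-injective uniq p q eq)

  ∈-take⇒lookup : ∀ {v : A} m xs → v L.∈ take m xs →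
                  Σ (Fin (length xs)) λ p → toℕ p < m × lookup xs p ≡ v
  ∈-take⇒lookup (suc m) (x ∷ xs) (here refl) = zero , s≤s z≤n , refl
  ∈-take⇒lookup (suc m) (x ∷ xs) (there v∈)  with ∈-take⇒lookup m xs v∈
  ... | p , p<m , eq = suc p , s≤s p<m , eq

  ∈-drop⇒lookup : ∀ {v : A} m xs → v L.∈ drop m xs →
                  Σ (Fin (length xs)) λ p → m ≤ toℕ p × lookup xs p ≡ v
  ∈-drop⇒lookup zero    xs       v∈ = index v∈ , z≤n , sym (lookup-index v∈)
  ∈-drop⇒lookup (suc m) (x ∷ xs) v∈ with ∈-drop⇒lookup m xs v∈
  ... | p , m≤p , eq = suc p , s≤s m≤p , eq

  last-lookup : ∀ {xs : List A} {v} → last xs ≡ just v →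
                Σ (Fin (length xs)) λ p → suc (toℕ p) ≡ length xs × lookup xs p ≡ v
  last-lookup {x ∷ []}     refl = zero , refl , refl
  last-lookup {x ∷ y ∷ xs} eq   with last-lookup {y ∷ xs} eq
  ... | p , p-last , p≡v = suc p , cong suc p-last , p≡v

  Unique-lookup≡head⇒toℕ≡0 : ∀ {xs : List A} {v} → Unique xs → head xs ≡ just v →
                              ∀ p → lookup xs p ≡ v → toℕ p ≡ 0
  Unique-lookup≡head⇒toℕ≡0 {x ∷ xs} _        refl zero    _  = refl
  Unique-lookup≡head⇒toℕ≡0 {x ∷ xs} (x∉ ∷ _) refl (suc p) eq = ⊥-elim (All.lookup x∉ (∈-lookup p) (sym eq))

  Unique-lookup≡last⇒suc-toℕ≡length : ∀ {xs : List A} {v} → Unique xs → last xs ≡ just v →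
                                       ∀ p → lookup xs p ≡ v → suc (toℕ p) ≡ length xs
  Unique-lookup≡last⇒suc-toℕ≡length {xs} uniq last≡ p eq with last-lookup {xs} last≡
  ... | q , q-last , q≡v =
    trans (cong (suc ∘ toℕ) (Unique⇒lookup-injective uniq p q (trans eq (sym q≡v)))) q-last

  head-take-suc : ∀ m (xs : List A) → head (take (suc m) xs) ≡ head xs
  head-take-suc m []      = refl
  head-take-suc m (_ ∷ _) = refl

  last-take-suc : ∀ (xs : List A) p → last (take (suc (toℕ p)) xs) ≡ just (lookup xs p)
  last-take-suc (x ∷ xs)     zero    = refl
  last-take-suc (x ∷ y ∷ xs) (suc p) = last-take-suc (y ∷ xs) p

  head-drop : ∀ (xs : List A) p → head (drop (toℕ p) xs) ≡ just (lookup xs p)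
  head-drop (x ∷ xs) zero    = refl
  head-drop (x ∷ xs) (suc p) = head-drop xs p

  last-drop : ∀ (xs : List A) (p : Fin (length xs)) → last (drop (toℕ p) xs) ≡ last xs
  last-drop (x ∷ xs)     zero    = refl
  last-drop (x ∷ y ∷ xs) (suc p) = last-drop (y ∷ xs) p

  head-++ : ∀ {xs : List A} {v} ys → head xs ≡ just v → head (xs ++ ys) ≡ just v
  head-++ {_ ∷ _} ys eq = eq

  last-++ : ∀ (xs : List A) {ys v} → last ys ≡ just v → last (xs ++ ys) ≡ just v
  last-++ []           eq = eq
  last-++ (x ∷ [])     {_ ∷ _} eq = eq
  last-++ (x ∷ y ∷ xs) eq = last-++ (y ∷ xs) eq

module _ {n : ℕ} (G : Graph n) where

  Chordless⇒¬Adj : ∀ {xs} → Chordless G xs → ∀ {p q : Fin (length xs)} {r} →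
                   toℕ p < r → r < toℕ q → ¬ Adj G (lookup xs p) (lookup xs q)
  Chordless⇒¬Adj chordless {p} {q} p<r r<q p~q with chordless p q p~q
  ... | inj₁ q≡1+p = <⇒≱ p<r (≤-pred (subst (_ <_) q≡1+p r<q))
  ... | inj₂ p≡1+q = <-asym (<-trans p<r r<q) (subst (toℕ q <_) (sym p≡1+q) (n<1+n (toℕ q)))

  Linked⇒ConnAvoid : ∀ {S x xs v} → Linked (Adj G) (x ∷ xs) → All (_∉ S) (x ∷ xs) →
                     last (x ∷ xs) ≡ just v → ConnAvoid G S x v
  Linked⇒ConnAvoid [-]      (x∉S ∷ _)    refl = here x∉S
  Linked⇒ConnAvoid (r ∷ rs) (x∉S ∷ xs∉S) eq   = step x∉S r (Linked⇒ConnAvoid rs xs∉S eq)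

  IsPath⇒ConnAvoid : ∀ {S u v xs} → IsPath G u v xs → All (_∉ S) xs → ConnAvoid G S u v
  IsPath⇒ConnAvoid {xs = _ ∷ _} (linked , _ , refl , last≡) avoids = Linked⇒ConnAvoid linked avoids last≡

  ConnAvoid-source∉ : ∀ {S u v} → ConnAvoid G S u v → u ∉ S
  ConnAvoid-source∉ (here u∉S)     = u∉S
  ConnAvoid-source∉ (step u∉S _ _) = u∉S

module CrossPaths {n : ℕ} (G : Graph n) {s t : Fin n} {k : ℕ} {P : Fin k → List (Fin n)}
  (isPath : ∀ i → IsPath G s t (P i))
  (internallyDisjoint : ∀ i j → ¬ i ≡ j → ∀ v → v L.∈ P i → v L.∈ P j → v ≡ s ⊎ v ≡ t)
  where

  unique : ∀ i → Unique (P i)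
  unique i = proj₁ (proj₂ (isPath i))

  lookup≡s⇒toℕ≡0 : ∀ i p → lookup (P i) p ≡ s → toℕ p ≡ 0
  lookup≡s⇒toℕ≡0 i = Unique-lookup≡head⇒toℕ≡0 (unique i) (proj₁ (proj₂ (proj₂ (isPath i))))

  lookup≡t⇒suc-toℕ≡length : ∀ i p → lookup (P i) p ≡ t → suc (toℕ p) ≡ length (P i)
  lookup≡t⇒suc-toℕ≡length i =
    Unique-lookup≡last⇒suc-toℕ≡length (unique i) (proj₂ (proj₂ (proj₂ (isPath i))))

  crossPath-IsPath : ∀ {i j a b} → i ≢ j → suc (toℕ a) < length (P i) → 0 < toℕ b →
                     Adj G (lookup (P i) a) (lookup (P j) b) → IsPath G s t (crossPath G P i j a b)
  crossPath-IsPath {i} {j} {a} {b} i≢j a≢last b≢first a~b = linked , unique-cross , head≡s , last≡t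
    where
    prefix suffix : List (Fin n)
    prefix = take (suc (toℕ a)) (P i)
    suffix = drop (toℕ b) (P j)

    linked : Linked (Adj G) (prefix ++ suffix)
    linked = Linked.++⁺ (Linked-take⁺ (suc (toℕ a)) (proj₁ (isPath i)))
      (subst₂ (Connected (Adj G)) (sym (last-take-suc (P i) a)) (sym (head-drop (P j) b)) (just a~b))
      (Linked-drop⁺ (toℕ b) (proj₁ (isPath j)))

    disjoint : Disjoint prefix suffix
    disjoint (v∈prefix , v∈suffix)
      with ∈-take⇒lookup _ (P i) v∈prefix | ∈-drop⇒lookup _ (P j) v∈suffix
    ... | p , p≤a , refl | q , b≤q , q≡v
      with internallyDisjoint i j i≢j _ (∈-lookup p) (subst (L._∈ P j) q≡v (∈-lookup q))
    ... | inj₁ v≡s = <⇒≢ (<-≤-trans b≢first b≤q) (sym (lookup≡s⇒toℕ≡0 j q (trans q≡v v≡s)))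
    ... | inj₂ v≡t = <⇒≢ (≤-<-trans p≤a a≢last) (lookup≡t⇒suc-toℕ≡length i p v≡t)

    unique-cross : Unique (prefix ++ suffix)
    unique-cross =
      Unique.++⁺ (Unique.take⁺ (suc (toℕ a)) (unique i)) (Unique.drop⁺ (toℕ b) (unique j)) disjoint

    head≡s : head (prefix ++ suffix) ≡ just s
    head≡s = head-++ suffix (trans (head-take-suc (toℕ a) (P i)) (proj₁ (proj₂ (proj₂ (isPath i)))))

    last≡t : last (prefix ++ suffix) ≡ just t
    last≡t = last-++ prefix (trans (last-drop (P j) b) (proj₂ (proj₂ (proj₂ (isPath j)))))

module BeforeCut {n : ℕ} (G : Graph n) {s t : Fin n} {k : ℕ} {P : Fin k → List (Fin n)}
  (paths : ∀ i → IsPath G s t (P i) × Chordless G (P i))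
  (internallyDisjoint : ∀ i j → ¬ i ≡ j → ∀ v → v L.∈ P i → v L.∈ P j → v ≡ s ⊎ v ≡ t)
  (cover : ∀ v → ∃[ i ] (v L.∈ P i))
  (S : Subset n) (s∉S : s ∉ S)
  (oneCut : ∀ i → Σ (Fin n) λ v → v L.∈ P i × v ∈ S × (∀ w → w L.∈ P i → w ∈ S → w ≡ v))
  where

  open CrossPaths G (proj₁ ∘ paths) internallyDisjoint

  private
    cut∈P : ∀ i → proj₁ (oneCut i) L.∈ P i
    cut∈P i = proj₁ (proj₂ (oneCut i))

  cutIndex : ∀ i → Fin (length (P i))
  cutIndex i = index (cut∈P i)

  cutIndex-∈S : ∀ i → lookup (P i) (cutIndex i) ∈ S
  cutIndex-∈S i = subst (_∈ S) (lookup-index (cut∈P i)) (proj₁ (proj₂ (proj₂ (oneCut i))))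

  ∈S⇒≡cutIndex : ∀ i p → lookup (P i) p ∈ S → p ≡ cutIndex i
  ∈S⇒≡cutIndex i p p∈S = Unique⇒lookup-injective (unique i) p (cutIndex i)
    (trans (proj₂ (proj₂ (proj₂ (oneCut i))) _ (∈-lookup p) p∈S) (lookup-index (cut∈P i)))

  BeforeCut : Fin n → Set
  BeforeCut u = Σ (Fin k) λ i → Σ (Fin (length (P i))) λ p →
                toℕ p < toℕ (cutIndex i) × lookup (P i) p ≡ u

  s-BeforeCut : BeforeCut s
  s-BeforeCut with cover s
  ... | i , s∈P = i , index s∈P , subst (_< toℕ (cutIndex i)) (sym s-first) (n≢0⇒n>0 cut≢0) , sym s≡
    where
    s≡ : s ≡ lookup (P i) (index s∈P)
    s≡ = lookup-index s∈P
    s-first : toℕ (index s∈P) ≡ 0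
    s-first = lookup≡s⇒toℕ≡0 i _ (sym s≡)
    cut≢0 : toℕ (cutIndex i) ≢ 0
    cut≢0 cut≡0 = s∉S (subst (_∈ S) (trans (cong (lookup (P i)) cut≡s-index) (sym s≡)) (cutIndex-∈S i))
      where
      cut≡s-index : cutIndex i ≡ index s∈P
      cut≡s-index = toℕ-injective (trans cut≡0 (sym s-first))

  t-¬BeforeCut : ¬ BeforeCut t
  t-¬BeforeCut (i , p , p<cut , p≡t) =
    <-irrefl (lookup≡t⇒suc-toℕ≡length i p p≡t) (≤-<-trans p<cut (toℕ<n (cutIndex i)))

  crossPath-avoids : ∀ {i j a b} → toℕ a < toℕ (cutIndex i) → toℕ (cutIndex j) < toℕ b →
                     All (_∉ S) (crossPath G P i j a b)
  crossPath-avoids {i} {j} {a} {b} a<cut cut<b =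
    AllP.++⁺ (All.tabulate prefix∉S) (All.tabulate suffix∉S)
    where
    prefix∉S : ∀ {v} → v L.∈ take (suc (toℕ a)) (P i) → v ∉ S
    prefix∉S v∈ v∈S with ∈-take⇒lookup _ (P i) v∈
    ... | p , p≤a , refl = <⇒≢ (≤-trans p≤a a<cut) (cong toℕ (∈S⇒≡cutIndex i p v∈S))
    suffix∉S : ∀ {v} → v L.∈ drop (toℕ b) (P j) → v ∉ S
    suffix∉S v∈ v∈S with ∈-drop⇒lookup _ (P j) v∈
    ... | q , b≤q , refl = <⇒≢ (<-≤-trans cut<b b≤q) (sym (cong toℕ (∈S⇒≡cutIndex j q v∈S)))

  adjacent-precedesCut : ¬ HasCrossPath G s t P S → ∀ {i p j q} → toℕ p < toℕ (cutIndex i) →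
                       Adj G (lookup (P i) p) (lookup (P j) q) → lookup (P j) q ∉ S →
                       toℕ q < toℕ (cutIndex j)
  adjacent-precedesCut noCross {i} {p} {j} {q} p<cut p~q q∉S with <-cmp (toℕ q) (toℕ (cutIndex j))
  ... | tri< q<cut _ _ = q<cut
  ... | tri≈ _ q≡cut _ =
    ⊥-elim (q∉S (subst (λ r → lookup (P j) r ∈ S) (sym (toℕ-injective q≡cut)) (cutIndex-∈S j)))
  ... | tri> _ _ cut<q with i ≟ᶠ j
  ...   | yes refl = ⊥-elim (Chordless⇒¬Adj G {P i} (proj₂ (paths i)) p<cut cut<q p~q)
  ...   | no i≢j = ⊥-elim (noCross (i , j , i≢j , p , q , p~q ,
            crossPath-IsPath i≢j (≤-<-trans p<cut (toℕ<n (cutIndex i))) (≤-<-trans z≤n cut<q) p~q ,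
            crossPath-avoids p<cut cut<q))

  ConnAvoid-BeforeCut : ¬ HasCrossPath G s t P S → ∀ {u v} →
                        BeforeCut u → ConnAvoid G S u v → BeforeCut v
  ConnAvoid-BeforeCut noCross u-before (here _) = u-before
  ConnAvoid-BeforeCut noCross (i , p , p<cut , refl) (step {w = w} _ u~w w~v) with cover w
  ... | j , w∈P = ConnAvoid-BeforeCut noCross (j , index w∈P , w<cut , sym w≡) w~v
    where
    w≡ : w ≡ lookup (P j) (index w∈P)
    w≡ = lookup-index w∈P
    w∉S : w ∉ S
    w∉S = ConnAvoid-source∉ G w~v
    w<cut : toℕ (index w∈P) < toℕ (cutIndex j)
    w<cut = adjacent-precedesCut noCross p<cut (subst (Adj G _) w≡ u~w) (subst (_∉ S) w≡ w∉S)

lemma7 : ∀ {n} (G : Graph n) (s t : Fin n) → ¬ s ≡ t → ¬ Adj G s t →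
    (k : ℕ) (P : Fin k → List (Fin n)) → IsCanonical G s t k P →
    (∀ v → ∃[ i ] (v L.∈ P i)) →
    (S : Subset n) → s ∉ S → t ∉ S →
    (∀ i → Σ (Fin n) λ v → v L.∈ P i × v ∈ S × (∀ w → w L.∈ P i → w ∈ S → w ≡ v)) →
    IsSeparator G s t S ⇔ (¬ HasCrossPath G s t P S)
lemma7 G s t _ _ k P (_ , paths , internallyDisjoint) cover S s∉S t∉S oneCut =
  mk⇔ separator⇒noCross noCross⇒separator
  where
  open BeforeCut G paths internallyDisjoint cover S s∉S oneCut

  separator⇒noCross : IsSeparator G s t S → ¬ HasCrossPath G s t P S
  separator⇒noCross (_ , _ , disconnected) (_ , _ , _ , _ , _ , _ , isPath , avoids) =
    disconnected (IsPath⇒ConnAvoid G isPath avoids)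

  noCross⇒separator : ¬ HasCrossPath G s t P S → IsSeparator G s t S
  noCross⇒separator noCross =
    s∉S , t∉S , λ s~t → t-¬BeforeCut (ConnAvoid-BeforeCut noCross s-BeforeCut s~t)
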